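{- Let $G$ and $G'$ be graphs with no isolated vertices such that the VCIr-TAR graphs of $G$ and $G'$ are isomorphic. Then $G$ and $G'$ have the same order and there is a relabeling of the vertices of $G'$ such that $G$ and $G'$ have exactly the same VCIr-sets.
   Context: Graphs are finite, simple, undirected. For a graph $G$ and $S\subseteq V(G)$, an edge $e=\{x,y\}$ of $G$ is a private edge of $u\in S$ (relative to $S$) if $S\cap e=\{u\}$. $S$ is a VCIr-set if every element of $S$ has a private edge. The VCIr-TAR graph of $G$ has as vertices the VCIr-sets of $G$, two being adjacent iff one is obtained from the other by adding or removing exactly one vertex. -}

module Defs where

open import Data.Nat using (ℕ)
open import Data.Fin using (Fin)
open import Data.Bool using (Bool; true; false)
open import Data.Vec using (lookup; tabulate)
open import Data.Fin.Subset using (Subset; _∈_; _∉_)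
open import Data.Product using (Σ; ∃; ∃-syntax; _×_; _,_)
open import Data.Sum using (_⊎_)
open import Relation.Binary.PropositionalEquality using (_≡_; _≢_)
open import Relation.Nullary using (¬_)
open import Function.Bundles using (_⇔_; _↔_; Inverse)

record Graph (n : ℕ) : Set where
  field
    adj   : Fin n → Fin n → Bool
    sym   : ∀ x y → adj x y ≡ adj y x
    irref : ∀ x → adj x x ≡ false

open Graph public

Adj : ∀ {n} → Graph n → Fin n → Fin n → Set
Adj G x y = adj G x y ≡ true

NoIsolated : ∀ {n} → Graph n → Set
NoIsolated {n} G = ∀ (v : Fin n) → ∃[ w ] Adj G v w

PrivateEdge : ∀ {n} → Graph n → Subset n → Fin n → Fin n → Fin n → Set
PrivateEdge {n} G S u x y =
  Adj G x y × (∀ (w : Fin n) → ((w ∈ S × (w ≡ x ⊎ w ≡ y)) ⇔ (w ≡ u)))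

VCIr : ∀ {n} → Graph n → Subset n → Set
VCIr {n} G S = ∀ (u : Fin n) → u ∈ S → ∃[ x ] ∃[ y ] PrivateEdge G S u x y

-- Adjacency in the VCIr-TAR graph: S and T differ in exactly one vertex
-- (one is obtained from the other by adding or removing exactly one vertex).
TARAdj : ∀ {n} → Subset n → Subset n → Set
TARAdj {n} S T =
  ∃[ v ] (lookup S v ≢ lookup T v × (∀ (w : Fin n) → w ≢ v → lookup S w ≡ lookup T w))

record TARIso {n m : ℕ} (G : Graph n) (G' : Graph m) : Set where
  field
    f        : Subset n → Subset m
    f-vcir   : ∀ S → VCIr G S → VCIr G' (f S)
    f-inj    : ∀ S T → VCIr G S → VCIr G T → f S ≡ f T → S ≡ T
    f-surj   : ∀ T → VCIr G' T → ∃[ S ] (VCIr G S × f S ≡ T)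
    f-adj    : ∀ S T → VCIr G S → VCIr G T → (TARAdj S T ⇔ TARAdj (f S) (f T))

image : ∀ {n m} → Fin n ↔ Fin m → Subset n → Subset m
image σ U = tabulate (λ j → lookup U (Inverse.from σ j))

-- Let f be the isomorphism and T₀ = f ∅. Since ∅ and all singletons are VCIr-sets, f {i} differs
-- from T₀ in exactly one coordinate τ i, and τ is injective because f is. By induction along ⊂,
-- f S = T₀ Δ τ[S] for every VCIr-set S: for distinct v, v' ∈ S, f S is a common neighbour of
-- T₀ Δ τ[S - v] and T₀ Δ τ[S - v'], two sets at Hamming distance 2 whose only common neighbours are
-- T₀ Δ τ[S] and T₀ Δ τ[S - v - v'] = f (S - v - v'), and the latter is ruled out by injectivity.
-- A coordinate outside the image of τ would take the same value on every f S, yet f reaches both ∅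
-- and a singleton; so τ is a bijection. As VCIr-sets are closed under subsets, U is a VCIr-set iff
-- τ[U] is, comparing U with f (U minus the i with τ i ∈ T₀) and τ[U] with f⁻¹ (τ[U] - T₀).

module Submission where

open import Defs hiding (sym)
open import Data.Nat using (ℕ)
open import Data.Fin using (Fin; zero; suc; _≟_)
open import Data.Fin.Subset using (Subset; _∈_; _∉_; _⊆_; _⊂_; _-_; _∩_; ∁; ⊥; ⁅_⁆; Nonempty)
open import Data.Fin.Subset.Properties
  using ( nonempty?; Empty-unique; ⊆-antisym; ⊂-trans; ∉⊥; p─⊥≡p; p∩q⊆p
        ; x∈⁅x⁆; x∈⁅y⁆⇒x≡y; x≢y⇒x∉⁅y⁆; x∈p∧x≢y⇒x∈p-y; x∈p⇒p-x⊂p )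
open import Data.Fin.Subset.Induction using (⊂-wellFounded)
open import Data.Fin.Properties using (any?; cantor-schröder-bernstein)
open import Data.Bool using (true; false; not; _∧_; _xor_)
open import Data.Bool.Properties using (¬-not; not-¬; not-distribʳ-xor; xor-identityʳ)
open import Data.Vec using (_∷_; lookup; tabulate)
open import Data.Vec.Properties
  using ( lookup∘tabulate; tabulate∘lookup; tabulate-cong
        ; lookup-replicate; lookup-zipWith; lookup-map; []=⇒lookup; lookup⇒[]= )
open import Data.Product using (Σ; ∃-syntax; _×_; _,_; proj₁; proj₂)
open import Data.Sum using (_⊎_; inj₁; inj₂; [_,_])
open import Function using (_∘_; id)
open import Function.Bundles using (_⇔_; _↔_; mk⇔; mk↔ₛ′; Equivalence)
open import Function.Definitions using (Injective)
open import Induction.WellFounded using (Acc; acc)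
open import Relation.Binary.PropositionalEquality
  using (_≡_; _≢_; refl; sym; trans; cong; subst; module ≡-Reasoning)
open import Relation.Nullary using (¬_; yes; no; contradiction)

private
  variable
    k n m : ℕ

xor-not-self : ∀ b → b xor not b ≡ true
xor-not-self false = refl
xor-not-self true  = refl

xor≡not⇒≡true : ∀ a {b} → a xor b ≡ not a → b ≡ true
xor≡not⇒≡true false         b≡true = b≡true
xor≡not⇒≡true true  {true}  _      = refl
xor≡not⇒≡true true  {false} ()

lookup-ext : {S T : Subset k} → (∀ i → lookup S i ≡ lookup T i) → S ≡ T
lookup-ext {S = S} {T} S≗T =
  trans (sym (tabulate∘lookup S)) (trans (tabulate-cong S≗T) (tabulate∘lookup T))

lookup-⁅x⁆-x : (x : Fin k) → lookup ⁅ x ⁆ x ≡ true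
lookup-⁅x⁆-x x = []=⇒lookup (x∈⁅x⁆ x)

lookup-⁅y⁆-x : {x y : Fin k} → x ≢ y → lookup ⁅ y ⁆ x ≡ false
lookup-⁅y⁆-x {x = x} {y} x≢y = ¬-not (x≢y⇒x∉⁅y⁆ x≢y ∘ lookup⇒[]= x ⁅ y ⁆)

lookup-remove-self : (S : Subset k) (v : Fin k) → lookup (S - v) v ≡ false
lookup-remove-self (_ ∷ _) zero    = refl
lookup-remove-self (_ ∷ S) (suc v) = lookup-remove-self S v

lookup-remove-other : (S : Subset k) {v w : Fin k} → w ≢ v → lookup (S - v) w ≡ lookup S w
lookup-remove-other (_ ∷ _) {zero}  {zero}  w≢v = contradiction refl w≢v
lookup-remove-other (_ ∷ S) {zero}  {suc w} _   = cong (λ R → lookup R w) (p─⊥≡p S)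
lookup-remove-other (_ ∷ _) {suc v} {zero}  _   = refl
lookup-remove-other (_ ∷ S) {suc v} {suc w} w≢v = lookup-remove-other S (w≢v ∘ cong suc)

lookup-∩∁ : (p q : Subset k) (i : Fin k) → lookup (p ∩ ∁ q) i ≡ lookup p i ∧ not (lookup q i)
lookup-∩∁ p q i = trans (lookup-zipWith _∧_ i p (∁ q)) (cong (lookup p i ∧_) (lookup-map i not q))

x∈p-y⇒x≢y : {p : Subset k} {x y : Fin k} → x ∈ p - y → x ≢ y
x∈p-y⇒x≢y {p = p} {x} x∈p-x refl with trans (sym ([]=⇒lookup x∈p-x)) (lookup-remove-self p x)
... | ()

x∈p∧p-x-empty⇒p≡⁅x⁆ : {p : Subset k} {x : Fin k} → x ∈ p → ¬ Nonempty (p - x) → p ≡ ⁅ x ⁆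
x∈p∧p-x-empty⇒p≡⁅x⁆ {p = p} {x} x∈p p-x-empty = ⊆-antisym p⊆⁅x⁆ ⁅x⁆⊆p
  where
  p⊆⁅x⁆ : p ⊆ ⁅ x ⁆
  p⊆⁅x⁆ {y} y∈p with y ≟ x
  ... | yes refl = x∈⁅x⁆ x
  ... | no y≢x   = contradiction (y , x∈p∧x≢y⇒x∈p-y y∈p y≢x) p-x-empty
  ⁅x⁆⊆p : ⁅ x ⁆ ⊆ p
  ⁅x⁆⊆p y∈⁅x⁆ = subst (_∈ p) (sym (x∈⁅y⁆⇒x≡y x y∈⁅x⁆)) x∈p

-- Chosen so that TARAdj S T is definitionally ∃ (DiffersOnlyAt S T).
DiffersOnlyAt : Subset k → Subset k → Fin k → Set
DiffersOnlyAt S T v = lookup S v ≢ lookup T v × (∀ w → w ≢ v → lookup S w ≡ lookup T w)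

differsOnlyAt-sym : {S T : Subset k} {v : Fin k} → DiffersOnlyAt S T v → DiffersOnlyAt T S v
differsOnlyAt-sym (S≢T , S≈T) = S≢T ∘ sym , λ w w≢v → sym (S≈T w w≢v)

differsOnlyAt-functional : {S T U : Subset k} {v : Fin k} →
                           DiffersOnlyAt S T v → DiffersOnlyAt S U v → T ≡ U
differsOnlyAt-functional {T = T} {U} {v} (S≢T , S≈T) (S≢U , S≈U) = lookup-ext T≗U
  where
  T≗U : ∀ w → lookup T w ≡ lookup U w
  T≗U w with w ≟ v
  ... | yes refl = trans (¬-not (S≢T ∘ sym)) (sym (¬-not (S≢U ∘ sym)))
  ... | no w≢v   = trans (sym (S≈T w w≢v)) (S≈U w w≢v)

differsOnlyAt-≢⇒≡ : {S T : Subset k} {v w : Fin k} →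
                    DiffersOnlyAt S T v → lookup S w ≢ lookup T w → w ≡ v
differsOnlyAt-≢⇒≡ {v = v} {w} (_ , S≈T) S≢T with w ≟ v
... | yes w≡v = w≡v
... | no w≢v  = contradiction (S≈T w w≢v) S≢T

differsOnlyAt-⊥-⁅⁆ : (i : Fin k) → DiffersOnlyAt ⊥ ⁅ i ⁆ i
differsOnlyAt-⊥-⁅⁆ i =
  (λ e → not-¬ (lookup-replicate i false) (trans e (lookup-⁅x⁆-x i))) ,
  λ w w≢i → trans (lookup-replicate w false) (sym (lookup-⁅y⁆-x w≢i))

differsOnlyAt-remove : {S : Subset k} {v : Fin k} → v ∈ S → DiffersOnlyAt S (S - v) v
differsOnlyAt-remove {S = S} {v} v∈S =
  (λ e → not-¬ ([]=⇒lookup v∈S) (trans e (lookup-remove-self S v))) ,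
  λ w w≢v → sym (lookup-remove-other S w≢v)

VCIr-antimono : (G : Graph k) {S T : Subset k} → S ⊆ T → VCIr G T → VCIr G S
VCIr-antimono G {S = S} S⊆T vT u u∈S with vT u (S⊆T u∈S)
... | x , y , x~y , private-xy = x , y , x~y , λ w → mk⇔
  (λ (w∈S , w∈xy) → Equivalence.to (private-xy w) (S⊆T w∈S , w∈xy))
  (λ w≡u → subst (_∈ S) (sym w≡u) u∈S , proj₂ (Equivalence.from (private-xy w) w≡u))

VCIr-⊥ : (G : Graph k) → VCIr G ⊥
VCIr-⊥ G u u∈⊥ = contradiction u∈⊥ ∉⊥

VCIr-⁅⁆ : (G : Graph k) → NoIsolated G → (i : Fin k) → VCIr G ⁅ i ⁆
VCIr-⁅⁆ G noIso i u u∈⁅i⁆ with noIso u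
... | w , u~w = u , w , u~w , λ w' → mk⇔
  (λ (w'∈⁅i⁆ , _) → trans (x∈⁅y⁆⇒x≡y i w'∈⁅i⁆) (sym (x∈⁅y⁆⇒x≡y i u∈⁅i⁆)))
  (λ w'≡u → subst (_∈ ⁅ i ⁆) (sym w'≡u) u∈⁅i⁆ , inj₁ w'≡u)

-- Flips τ T S X says X = T Δ τ[S] (for injective τ).
record Flips (τ : Fin n → Fin m) (T : Subset m) (S : Subset n) (X : Subset m) : Set where
  field
    on-image  : ∀ i → lookup X (τ i) ≡ lookup T (τ i) xor lookup S i
    off-image : ∀ j → (∀ i → τ i ≢ j) → lookup X j ≡ lookup T j

open Flips

module _ {τ : Fin n → Fin m} {T : Subset m} where

  flips-⊥ : Flips τ T ⊥ T
  flips-⊥ = record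
    { on-image  = λ i → sym (trans (cong (lookup T (τ i) xor_) (lookup-replicate i false))
                                   (xor-identityʳ (lookup T (τ i))))
    ; off-image = λ _ _ → refl
    }

  flips-unique : {S : Subset n} {X Y : Subset m} → Flips τ T S X → Flips τ T S Y → X ≡ Y
  flips-unique {X = X} {Y} FX FY = lookup-ext X≗Y
    where
    X≗Y : ∀ j → lookup X j ≡ lookup Y j
    X≗Y j with any? (λ i → τ i ≟ j)
    ... | yes (i , refl) = trans (on-image FX i) (sym (on-image FY i))
    ... | no ∄i          = trans (off-image FX j τ∌j) (sym (off-image FY j τ∌j))
      where τ∌j = λ i τi≡j → ∄i (i , τi≡j)

  flips-≢ : {P Q : Subset n} {X Y : Subset m} {i : Fin n} → Flips τ T P X → Flips τ T Q Y →
            lookup P i ≢ lookup Q i → lookup X (τ i) ≢ lookup Y (τ i)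
  flips-≢ {P} {Q} {X} {Y} {i} FX FY P≢Q X≡Y = not-¬ refl (trans (sym X≡Y) X≡notY)
    where
    open ≡-Reasoning
    X≡notY : lookup X (τ i) ≡ not (lookup Y (τ i))
    X≡notY = begin
      lookup X (τ i)                        ≡⟨ on-image FX i ⟩
      lookup T (τ i) xor lookup P i         ≡⟨ cong (lookup T (τ i) xor_) (¬-not P≢Q) ⟩
      lookup T (τ i) xor not (lookup Q i)   ≡⟨ not-distribʳ-xor (lookup T (τ i)) (lookup Q i) ⟨
      not (lookup T (τ i) xor lookup Q i)   ≡⟨ cong not (sym (on-image FY i)) ⟩
      not (lookup Y (τ i))                  ∎

  flips-step : Injective _≡_ _≡_ τ → {P Q : Subset n} {X Y : Subset m} {i : Fin n} →
               Flips τ T P X → DiffersOnlyAt X Y (τ i) → DiffersOnlyAt P Q i → Flips τ T Q Y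
  flips-step τ-inj {P} {Q} {X} {Y} {i} FX (X≢Y , X≈Y) (P≢Q , P≈Q) = record
    { on-image  = on
    ; off-image = λ j τ∌j → trans (sym (X≈Y j (τ∌j i ∘ sym))) (off-image FX j τ∌j)
    }
    where
    open ≡-Reasoning
    on : ∀ k → lookup Y (τ k) ≡ lookup T (τ k) xor lookup Q k
    on k with k ≟ i
    ... | yes refl = begin
      lookup Y (τ i)                        ≡⟨ ¬-not (X≢Y ∘ sym) ⟩
      not (lookup X (τ i))                  ≡⟨ cong not (on-image FX i) ⟩
      not (lookup T (τ i) xor lookup P i)   ≡⟨ not-distribʳ-xor (lookup T (τ i)) (lookup P i) ⟩
      lookup T (τ i) xor not (lookup P i)   ≡⟨ cong (lookup T (τ i) xor_) (¬-not (P≢Q ∘ sym)) ⟨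
      lookup T (τ i) xor lookup Q i         ∎
    ... | no k≢i = begin
      lookup Y (τ k)                        ≡⟨ X≈Y (τ k) (k≢i ∘ τ-inj) ⟨
      lookup X (τ k)                        ≡⟨ on-image FX k ⟩
      lookup T (τ k) xor lookup P k         ≡⟨ cong (lookup T (τ k) xor_) (P≈Q k k≢i) ⟩
      lookup T (τ k) xor lookup Q k         ∎

  flips-common-neighbour :
    Injective _≡_ _≡_ τ → {S Sa Sb S₂ : Subset n} {v v' : Fin n} {A B Y : Subset m} →
    v ≢ v' → DiffersOnlyAt S Sa v → DiffersOnlyAt S Sb v' → DiffersOnlyAt Sa S₂ v' →
    Flips τ T Sa A → Flips τ T Sb B → TARAdj Y A → TARAdj Y B →
    Flips τ T S Y ⊎ Flips τ T S₂ Y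
  flips-common-neighbour τ-inj {S} {Sa} {Sb} {v = v} {v'} {A} {B} {Y}
                         v≢v' S~Sa S~Sb Sa~S₂ FA FB (c , Y~A) (_ , Y~B)
    with c ≟ τ v | c ≟ τ v'
  ... | yes refl | _        = inj₁ (flips-step τ-inj FA A~Y (differsOnlyAt-sym {S = S} {Sa} S~Sa))
    where A~Y = differsOnlyAt-sym {S = Y} {A} Y~A
  ... | no _     | yes refl = inj₂ (flips-step τ-inj FA A~Y Sa~S₂)
    where A~Y = differsOnlyAt-sym {S = Y} {A} Y~A
  ... | no c≢τv  | no c≢τv' = contradiction (τ-inj (trans τv≡c' (sym τv'≡c'))) v≢v'
    where
    -- Y agrees with A at τ v and τ v', and A differs from B at both; so Y differs from B twice.
    Y≢B : ∀ {i} → c ≢ τ i → lookup Sa i ≢ lookup Sb i → lookup Y (τ i) ≢ lookup B (τ i)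
    Y≢B {i} c≢τi Sa≢Sb Y≡B = flips-≢ FA FB Sa≢Sb (trans (sym (proj₂ Y~A (τ i) (c≢τi ∘ sym))) Y≡B)
    Sa≢Sb-at-v : lookup Sa v ≢ lookup Sb v
    Sa≢Sb-at-v e = proj₁ S~Sa (trans (proj₂ S~Sb v v≢v') (sym e))
    Sa≢Sb-at-v' : lookup Sa v' ≢ lookup Sb v'
    Sa≢Sb-at-v' e = proj₁ S~Sb (trans (proj₂ S~Sa v' (v≢v' ∘ sym)) e)
    τv≡c' = differsOnlyAt-≢⇒≡ {S = Y} {B} Y~B (Y≢B c≢τv Sa≢Sb-at-v)
    τv'≡c' = differsOnlyAt-≢⇒≡ {S = Y} {B} Y~B (Y≢B c≢τv' Sa≢Sb-at-v')

module Reconstruction {G : Graph n} {G' : Graph m}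
                      (noIsoG : NoIsolated G) (noIsoG' : NoIsolated G') (I : TARIso G G') where
  open TARIso I

  T₀ : Subset m
  T₀ = f ⊥

  τ-adj : ∀ i → TARAdj T₀ (f ⁅ i ⁆)
  τ-adj i = Equivalence.to (f-adj ⊥ ⁅ i ⁆ (VCIr-⊥ G) (VCIr-⁅⁆ G noIsoG i))
                           (i , differsOnlyAt-⊥-⁅⁆ i)

  τ : Fin n → Fin m
  τ i = proj₁ (τ-adj i)

  τ-injective : Injective _≡_ _≡_ τ
  τ-injective {i} {j} τi≡τj = x∈⁅y⁆⇒x≡y j (subst (i ∈_) ⁅i⁆≡⁅j⁆ (x∈⁅x⁆ i))
    where
    f⁅i⁆≡f⁅j⁆ : f ⁅ i ⁆ ≡ f ⁅ j ⁆
    f⁅i⁆≡f⁅j⁆ = differsOnlyAt-functional {S = T₀} (proj₂ (τ-adj i))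
                  (subst (DiffersOnlyAt T₀ (f ⁅ j ⁆)) (sym τi≡τj) (proj₂ (τ-adj j)))
    ⁅i⁆≡⁅j⁆ : ⁅ i ⁆ ≡ ⁅ j ⁆
    ⁅i⁆≡⁅j⁆ = f-inj ⁅ i ⁆ ⁅ j ⁆ (VCIr-⁅⁆ G noIsoG i) (VCIr-⁅⁆ G noIsoG j) f⁅i⁆≡f⁅j⁆

  flips-⁅⁆ : ∀ i → Flips τ T₀ ⁅ i ⁆ (f ⁅ i ⁆)
  flips-⁅⁆ i = flips-step τ-injective flips-⊥ (proj₂ (τ-adj i)) (differsOnlyAt-⊥-⁅⁆ i)

  flips-inductive-step : {S : Subset n} {v v' : Fin n} → VCIr G S → v ∈ S → v' ∈ S - v →
                         (∀ {R} → R ⊂ S → Flips τ T₀ R (f R)) → Flips τ T₀ S (f S)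
  flips-inductive-step {S} {v} {v'} vS v∈S v'∈S-v below =
    [ id , (λ flips-S₂ → contradiction (v∈S₂ flips-S₂) v∉S₂) ]
      (flips-common-neighbour τ-injective v≢v'
        (differsOnlyAt-remove v∈S) (differsOnlyAt-remove v'∈S) (differsOnlyAt-remove v'∈S-v)
        (below S-v⊂S) (below S-v'⊂S) (adjacent-after-removal v∈S) (adjacent-after-removal v'∈S))
    where
    S-v⊂S = x∈p⇒p-x⊂p v∈S
    v'∈S = proj₁ S-v⊂S v'∈S-v
    S-v'⊂S = x∈p⇒p-x⊂p v'∈S
    S₂⊂S-v = x∈p⇒p-x⊂p v'∈S-v
    S₂⊂S = ⊂-trans S₂⊂S-v S-v⊂S
    v≢v' : v ≢ v'
    v≢v' v≡v' = x∈p-y⇒x≢y v'∈S-v (sym v≡v')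
    adjacent-after-removal : ∀ {x} → x ∈ S → TARAdj (f S) (f (S - x))
    adjacent-after-removal {x} x∈S = Equivalence.to
      (f-adj S (S - x) vS (VCIr-antimono G (proj₁ (x∈p⇒p-x⊂p x∈S)) vS))
      (x , differsOnlyAt-remove x∈S)
    v∈S₂ : Flips τ T₀ (S - v - v') (f S) → v ∈ S - v - v'
    v∈S₂ flips-S₂ = subst (v ∈_) S≡S₂ v∈S
      where
      S≡S₂ = f-inj S (S - v - v') vS (VCIr-antimono G (proj₁ S₂⊂S) vS)
                   (flips-unique flips-S₂ (below S₂⊂S))
    v∉S₂ : v ∉ S - v - v'
    v∉S₂ v∈S₂ = x∈p-y⇒x≢y (proj₁ S₂⊂S-v v∈S₂) refl

  f-flips : ∀ S → VCIr G S → Flips τ T₀ S (f S)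
  f-flips S = flips-acc S (⊂-wellFounded S)
    where
    flips-acc : ∀ S → Acc _⊂_ S → VCIr G S → Flips τ T₀ S (f S)
    flips-acc S (acc rec) vS with nonempty? S
    ... | no S-empty = subst (λ R → Flips τ T₀ R (f R)) (sym (Empty-unique S-empty)) flips-⊥
    ... | yes (v , v∈S) with nonempty? (S - v)
    ...   | no S-v-empty =
      subst (λ R → Flips τ T₀ R (f R)) (sym (x∈p∧p-x-empty⇒p≡⁅x⁆ v∈S S-v-empty)) (flips-⁅⁆ v)
    ...   | yes (_ , v'∈S-v) = flips-inductive-step vS v∈S v'∈S-v
                                  (λ R⊂S → flips-acc _ (rec R⊂S) (VCIr-antimono G (proj₁ R⊂S) vS))

  τ-surjective : ∀ j → ∃[ i ] τ i ≡ j
  τ-surjective j with any? (λ i → τ i ≟ j)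
  ... | yes τ∋j = τ∋j
  ... | no τ∌j  = contradiction true≡false λ ()
    where
    agrees-with-T₀ : ∀ X → VCIr G' X → lookup X j ≡ lookup T₀ j
    agrees-with-T₀ X vX with f-surj X vX
    ... | S , vS , refl = off-image (f-flips S vS) j (λ i τi≡j → τ∌j (i , τi≡j))
    open ≡-Reasoning
    true≡false : true ≡ false
    true≡false = begin
      true           ≡⟨ sym (lookup-⁅x⁆-x j) ⟩
      lookup ⁅ j ⁆ j ≡⟨ agrees-with-T₀ ⁅ j ⁆ (VCIr-⁅⁆ G' noIsoG' j) ⟩
      lookup T₀ j    ≡⟨ sym (agrees-with-T₀ ⊥ (VCIr-⊥ G')) ⟩
      lookup ⊥ j     ≡⟨ lookup-replicate j false ⟩
      false          ∎

  τ⁻¹ : Fin m → Fin n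
  τ⁻¹ j = proj₁ (τ-surjective j)

  τ∘τ⁻¹ : ∀ j → τ (τ⁻¹ j) ≡ j
  τ∘τ⁻¹ j = proj₂ (τ-surjective j)

  τ⁻¹∘τ : ∀ i → τ⁻¹ (τ i) ≡ i
  τ⁻¹∘τ i = τ-injective (τ∘τ⁻¹ (τ i))

  σ : Fin n ↔ Fin m
  σ = mk↔ₛ′ τ τ⁻¹ τ∘τ⁻¹ τ⁻¹∘τ

  n≡m : n ≡ m
  n≡m = cantor-schröder-bernstein τ-injective τ⁻¹-injective
    where
    τ⁻¹-injective : Injective _≡_ _≡_ τ⁻¹
    τ⁻¹-injective {j} {j'} e = trans (sym (τ∘τ⁻¹ j)) (trans (cong τ e) (τ∘τ⁻¹ j'))

  lookup-image : ∀ U j → lookup (image σ U) j ≡ lookup U (τ⁻¹ j)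
  lookup-image U = lookup∘tabulate (lookup U ∘ τ⁻¹)

  lookup-image-τ : ∀ U i → lookup (image σ U) (τ i) ≡ lookup U i
  lookup-image-τ U i = trans (lookup-image U (τ i)) (cong (lookup U) (τ⁻¹∘τ i))

  image-VCIr : ∀ U → VCIr G U → VCIr G' (image σ U)
  image-VCIr U vU = VCIr-antimono G' image⊆fU' (f-vcir U' vU')
    where
    T₀∘τ : Subset n
    T₀∘τ = tabulate (lookup T₀ ∘ τ)
    -- Dropping the i with τ i ∈ T₀ makes every flip turn a coordinate of τ[U] on.
    U' : Subset n
    U' = U ∩ ∁ T₀∘τ
    vU' : VCIr G U'
    vU' = VCIr-antimono G (p∩q⊆p U (∁ T₀∘τ)) vU
    fU'-at-τ : ∀ {i} → lookup U i ≡ true → lookup (f U') (τ i) ≡ true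
    fU'-at-τ {i} Ui≡true = begin
      lookup (f U') (τ i)            ≡⟨ on-image (f-flips U' vU') i ⟩
      t xor lookup U' i              ≡⟨ cong (t xor_) (lookup-∩∁ U T₀∘τ i) ⟩
      t xor (lookup U i ∧ not t′)    ≡⟨ cong (λ b → t xor (b ∧ not t′)) Ui≡true ⟩
      t xor not t′                   ≡⟨ cong (λ b → t xor not b) (lookup∘tabulate (lookup T₀ ∘ τ) i) ⟩
      t xor not t                    ≡⟨ xor-not-self t ⟩
      true                           ∎
      where
      open ≡-Reasoning
      t = lookup T₀ (τ i)
      t′ = lookup T₀∘τ i
    image⊆fU' : image σ U ⊆ f U'
    image⊆fU' {j} j∈image = lookup⇒[]= j (f U') (subst (λ j → lookup (f U') j ≡ true) (τ∘τ⁻¹ j)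
      (fU'-at-τ (trans (sym (lookup-image U j)) ([]=⇒lookup j∈image))))

  VCIr-from-image : ∀ U → VCIr G' (image σ U) → VCIr G U
  VCIr-from-image U vX with f-surj (image σ U ∩ ∁ T₀) (VCIr-antimono G' (p∩q⊆p (image σ U) (∁ T₀)) vX)
  ... | W , vW , fW≡X' = VCIr-antimono G U⊆W vW
    where
    U⊆W : U ⊆ W
    U⊆W {i} i∈U = lookup⇒[]= i W (xor≡not⇒≡true t (begin
      t xor lookup W i                         ≡⟨ on-image (f-flips W vW) i ⟨
      lookup (f W) (τ i)                       ≡⟨ cong (λ Y → lookup Y (τ i)) fW≡X' ⟩
      lookup (image σ U ∩ ∁ T₀) (τ i)          ≡⟨ lookup-∩∁ (image σ U) T₀ (τ i) ⟩
      lookup (image σ U) (τ i) ∧ not t         ≡⟨ cong (_∧ not t) (lookup-image-τ U i) ⟩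
      lookup U i ∧ not t                       ≡⟨ cong (_∧ not t) ([]=⇒lookup i∈U) ⟩
      not t                                    ∎))
      where
      open ≡-Reasoning
      t = lookup T₀ (τ i)

theorem3p66 : ∀ {n m : ℕ} (G : Graph n) (G' : Graph m)
    → NoIsolated G → NoIsolated G' → TARIso G G'
    → n ≡ m × (Σ (Fin n ↔ Fin m) λ σ → ∀ (U : Subset n) → (VCIr G U ⇔ VCIr G' (image σ U)))
theorem3p66 G G' noIsoG noIsoG' I = n≡m , σ , λ U → mk⇔ (image-VCIr U) (VCIr-from-image U)
  where
  open Reconstruction noIsoG noIsoG' I
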